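{- Let $G$ be a connected multigraph with $m=|E(G)|\ge 1$ edges, edge weights $w_e\in\{ -1,1\}$, and let $k\ge -1$ be rational. Let $G'$ and $T$ be constructed from $(G,\mathbf{w})$ as described in the context. Then there exists $\epsilon$ such that, with $\alpha=(2+k)/3-\epsilon$: (i) for every nontrivial cut $(A,B)$ of $G$ with $\left(\sum_{e\in\delta_G(A)} w_e\right)/|\delta_G(A)|\ge k$, the corresponding cut $(A',B')$ of $G'$, where $A'=\bigcup_{a\in A} c_a$, satisfies $|\delta_T(A')|/|\delta_{G'}(A')|>\alpha$; and (ii) every cut $(A',B')$ of $G'$ which respects all cliques (i.e. $A'=\bigcup_{a\in A}c_a$ for some nonempty proper $A\subseteq V(G)$) and satisfies $|\delta_T(A')|/|\delta_{G'}(A')|>\alpha$ corresponds to a cut $(A,B)$ of $G$ with $\left(\sum_{e\in\delta_G(A)} w_e\right)/|\delta_G(A)|\ge k$.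
   Context: For a subgraph $S$ and vertex set $A$, $\delta_S(A)$ is the set of edges of $S$ with exactly one endpoint in $A$. Construction of $G'$: for each $v\in V(G)$ add a clique $c_v$ on $24m$ new vertices; for each edge $e=(v,w)$ of $G$, choose three pairs $(v_i,w_i)$, $i=0,1,2$, with $v_i\in c_v$, $w_i\in c_w$, all chosen vertices distinct from each other and from vertices chosen for other edges (so every vertex of $G'$ is incident to at most one edge between different cliques), and add the three edges $(v_i,w_i)$; call this set of three edges $d_e$. Construction of $T$: let $S$ be the spanning subgraph of $G'$ consisting of a path through all vertices of each clique $c_v$, together with, for each $e\in E(G)$, $w_e+2$ of the edges of $d_e$; then repeatedly, while the current subgraph contains a cycle, remove from it an edge of the cycle lying inside some clique; the result $T$ is a spanning tree of $G'$. -}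

module Defs where

open import Data.Nat as ℕ using (ℕ; zero; suc; _<ᵇ_)
open import Data.Integer as ℤ using (ℤ; +_; -[1+_])
open import Data.Rational as ℚ using (ℚ; 0ℚ)
open import Data.Bool using (Bool; true; false; _xor_; _∧_)
open import Data.Fin as Fin using (Fin; zero; suc; toℕ)
open import Data.List using (List; []; _∷_; _++_; length; map; concatMap; filterᵇ; allFin; foldr)
open import Data.List.Membership.Propositional using (_∈_)
open import Data.List.Relation.Unary.Unique.Propositional using (Unique)
open import Data.Maybe using (Maybe; just; nothing; maybe)
import Data.Maybe as Maybe
open import Data.Product using (Σ; ∃; _×_; _,_; proj₁; proj₂)
open import Data.Sum using (_⊎_)
open import Function using (id; _∘_; Injective)
open import Relation.Binary.PropositionalEquality using (_≡_; _≢_)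
open import Relation.Binary.Construct.Closure.ReflexiveTransitive using (Star)
open import Relation.Nullary using (¬_)

-- p / q in ℚ, with the (never used) convention p / 0 = 0.
frac : ℤ → ℕ → ℚ
frac p zero    = 0ℚ
frac p (suc d) = p ℚ./ suc d

sumℤ : List ℤ → ℤ
sumℤ = foldr ℤ._+_ (+ 0)

sucM : ∀ {k} → Fin k → Maybe (Fin k)
sucM {suc zero}    zero    = nothing
sucM {suc (suc k)} zero    = just (suc zero)
sucM {suc (suc k)} (suc i) = Maybe.map suc (sucM {suc k} i)

next : ∀ {k} → Fin k → Fin k
next {suc k} i = maybe id zero (sucM i)

pathPairs : ∀ {A : Set} {M : ℕ} → (Fin M → A) → List (A × A)
pathPairs {M = zero}        f = []
pathPairs {M = suc zero}    f = []
pathPairs {M = suc (suc M)} f = (f zero , f (suc zero)) ∷ pathPairs {M = suc M} (f ∘ suc)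

Joins : ∀ {V : Set} → V × V → V → V → Set
Joins (x , y) u v = (x ≡ u × y ≡ v) ⊎ (x ≡ v × y ≡ u)

record Cycle {V E : Set} (ends : E → V × V) (H : List E) : Set where
  field
    len    : ℕ
    vtx    : Fin (suc len) → V
    edg    : Fin (suc len) → E
    vtxInj : Injective _≡_ _≡_ vtx
    edgInj : Injective _≡_ _≡_ edg
    edgIn  : ∀ i → edg i ∈ H
    joins  : ∀ i → Joins (ends (edg i)) (vtx i) (vtx (next i))

HasCycle : ∀ {V E : Set} → (E → V × V) → List E → Set
HasCycle ends H = Cycle ends H

δ : ∀ {V E : Set} → (E → V × V) → (V → Bool) → List E → List E
δ ends A = filterᵇ (λ e → A (proj₁ (ends e)) xor A (proj₂ (ends e)))

record Multigraph : Set where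
  field
    n    : ℕ
    m    : ℕ
    ends : Fin m → Fin n × Fin n
  src : Fin m → Fin n
  src e = proj₁ (ends e)
  tgt : Fin m → Fin n
  tgt e = proj₂ (ends e)
  edges : List (Fin m)
  edges = allFin m

Loopless : Multigraph → Set
Loopless G = ∀ e → src e ≢ tgt e
  where open Multigraph G

data Reach (G : Multigraph) : Fin (Multigraph.n G) → Fin (Multigraph.n G) → Set where
  here : ∀ {u} → Reach G u u
  step : ∀ {u v w} (e : Fin (Multigraph.m G)) →
         Joins (Multigraph.ends G e) u v → Reach G v w → Reach G u w

Connected : Multigraph → Set
Connected G = ∀ u v → Reach G u v

Weights : Multigraph → Set
Weights G = Σ (Fin (Multigraph.m G) → ℤ) λ w → ∀ e → w e ≡ + 1 ⊎ w e ≡ -[1+ 0 ]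

Nontrivial : ∀ {n} → (Fin n → Bool) → Set
Nontrivial A = (∃ λ a → A a ≡ true) × (∃ λ b → A b ≡ false)

cutAvg : (G : Multigraph) → (Fin (Multigraph.m G) → ℤ) → (Fin (Multigraph.n G) → Bool) → ℚ
cutAvg G w A = frac (sumℤ (map w cut)) (length cut)
  where open Multigraph G
        cut = δ ends A edges

cliqueSize : Multigraph → ℕ
cliqueSize G = 24 ℕ.* Multigraph.m G

-- vertices of G': (v , i) is the i-th vertex of clique c_v
V' : Multigraph → Set
V' G = Fin (Multigraph.n G) × Fin (cliqueSize G)

-- edges of G': clique edges (v,i)-(v,j), and the three edges d_e of each e
data E' (G : Multigraph) : Set where
  clq : Fin (Multigraph.n G) → Fin (cliqueSize G) → Fin (cliqueSize G) → E' G
  crs : Fin (Multigraph.m G) → Fin 3 → E' G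

-- Choice of the endpoints of the edges of d_e:
-- pt e i false ∈ c_{src e} is v_i, pt e i true ∈ c_{tgt e} is w_i.
endptOf : (G : Multigraph) → (Fin (Multigraph.m G) → Fin 3 → Bool → Fin (cliqueSize G)) →
          Fin (Multigraph.m G) → Fin 3 → Bool → V' G
endptOf G pt e i false = Multigraph.src G e , pt e i false
endptOf G pt e i true  = Multigraph.tgt G e , pt e i true

record Gadget (G : Multigraph) : Set where
  open Multigraph G
  field
    pt : Fin m → Fin 3 → Bool → Fin (cliqueSize G)
    endptInj : ∀ e i b e′ i′ b′ → endptOf G pt e i b ≡ endptOf G pt e′ i′ b′ →
               (e ≡ e′ × i ≡ i′ × b ≡ b′)
  endpt : Fin m → Fin 3 → Bool → V' G
  endpt = endptOf G pt
  ends' : E' G → V' G × V' G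
  ends' (clq v i j) = (v , i) , (v , j)
  ends' (crs e i)   = endpt e i false , endpt e i true
  edges' : List (E' G)
  edges' = concatMap (λ v → concatMap (λ i →
             concatMap (λ j → if' (toℕ i <ᵇ toℕ j) (clq v i j)) (allFin (cliqueSize G)))
               (allFin (cliqueSize G))) (allFin n)
           ++ concatMap (λ e → map (crs e) (allFin 3)) (allFin m)
    where
      if' : Bool → E' G → List (E' G)
      if' true  x = x ∷ []
      if' false x = []

-- Data determining S: a Hamiltonian path order σ_v of each clique, and
-- for each e a set of w_e + 2 of the three edges of d_e.
record PathAndSelection (G : Multigraph) (w : Fin (Multigraph.m G) → ℤ) : Set where
  open Multigraph G
  field
    σ      : Fin n → Fin (cliqueSize G) → Fin (cliqueSize G)
    σInj   : ∀ v → Injective _≡_ _≡_ (σ v)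
    sel    : Fin m → List (Fin 3)
    selUnique : ∀ e → Unique (sel e)
    selSize   : ∀ e → + length (sel e) ≡ w e ℤ.+ + 2

Sgraph : (G : Multigraph) (w : Fin (Multigraph.m G) → ℤ) → PathAndSelection G w → List (E' G)
Sgraph G w P =
  concatMap (λ v → map (λ ij → clq v (proj₁ ij) (proj₂ ij)) (pathPairs (σ v))) (allFin n)
  ++ concatMap (λ e → map (crs e) (sel e)) (allFin m)
  where open Multigraph G
        open PathAndSelection P

IsCliqueEdge : ∀ {G} → E' G → Set
IsCliqueEdge (clq _ _ _) = Data.Unit.⊤ where import Data.Unit
IsCliqueEdge (crs _ _)   = Data.Empty.⊥ where import Data.Empty

Step : ∀ {G} → Gadget G → List (E' G) → List (E' G) → Set
Step Γ H H′ = Σ (Cycle (Gadget.ends' Γ) H) λ C →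
  Σ (Fin (suc (Cycle.len C))) λ i →
    IsCliqueEdge (Cycle.edg C i) ×
    (∃ λ xs → ∃ λ ys → H ≡ xs ++ Cycle.edg C i ∷ ys × H′ ≡ xs ++ ys)

IsResultT : ∀ {G} → Gadget G → List (E' G) → List (E' G) → Set
IsResultT Γ S T = Star (Step Γ) S T × ¬ HasCycle (Gadget.ends' Γ) T

liftCut : ∀ {G} → (Fin (Multigraph.n G) → Bool) → V' G → Bool
liftCut A x = A (proj₁ x)

treeRatio : ∀ {G} → Gadget G → List (E' G) → (V' G → Bool) → ℚ
treeRatio Γ T A' = frac (+ length (δ ends' A' T)) (length (δ ends' A' edges'))
  where open Gadget Γ

alpha : ℚ → ℚ → ℚ
alpha k ε = ((+ 2 ℚ./ 1) ℚ.+ k) ℚ.* (+ 1 ℚ./ 3) ℚ.- ε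

-- Clique edges never cross a cut A' that respects the cliques, and going from S to T only deletes
-- clique edges.  So δ_{G'}(A') consists of the three edges d_e for each e ∈ δ_G(A), and δ_T(A') of the
-- w_e + 2 selected ones among them: with d = |δ_G(A)| and s = Σ_{e ∈ δ_G(A)} w_e,
--   |δ_T(A')| / |δ_{G'}(A')| = (s + 2d) / 3d = (2 + s/d) / 3,
-- an increasing function of the average weight s/d.  As d ≤ m, an average s/d < k is at most
-- k − 1/(m · den k), so α = (2 + k)/3 − 1/(3 m · den k) separates averages ≥ k from averages < k.
module Submission where

open import Defs
import Algebra.Properties.AbelianGroup as AbelianGroupProperties
open import Data.Bool using (Bool; true; false; _xor_; T)
open import Data.Bool.Properties using (T?; xor-same)
open import Data.Fin using (Fin; toℕ)
open import Data.Integer as ℤ using (ℤ; +_; 0ℤ; _+_; _*_; _-_; -_; _≤_; _<_)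
import Data.Integer.Properties as ℤP
open import Data.Integer.Tactic.RingSolver using (solve; solve-∀)
open import Data.List using (List; []; _∷_; _++_; length; map; concatMap; filterᵇ; allFin)
open import Data.List.Membership.Propositional using (_∈_)
open import Data.List.Membership.Propositional.Properties using (∈-allFin)
open import Data.List.Properties
  using (length-++; length-map; length-filter; length-tabulate; filter-++; filter-all; filter-none; filter-reject; filter-some)
open import Data.List.Relation.Unary.All as All using (All)
open import Data.List.Relation.Unary.All.Properties using (concat⁺; map⁺)
import Data.List.Relation.Unary.Any as Any
open import Data.Nat as ℕ using (ℕ; suc; NonZero; _<ᵇ_)
open import Data.Nat.ListAction using (sum)
import Data.Nat.Properties as ℕP
open import Data.Product using (Σ; ∃; _×_; _,_; proj₁; proj₂)
open import Data.Rational as ℚ using (ℚ; _/_; ↥_; ↧_; ↧ₙ_; toℚᵘ)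
import Data.Rational.Properties as ℚP
open import Data.Rational.Unnormalised as ℚᵘ using (mkℚᵘ; *≤*; *<*)
import Data.Rational.Unnormalised.Properties as ℚᵘP
open import Data.Sum using (inj₁; inj₂)
open import Data.Unit using (tt)
open import Function using (_∘_)
open import Relation.Binary.Construct.Closure.ReflexiveTransitive as Star using (Star)
open import Relation.Binary.PropositionalEquality using (_≡_; refl; sym; trans; cong; cong₂; subst; subst₂; module ≡-Reasoning)

toℚᵘ-/ : ∀ p d .{{_ : NonZero d}} → toℚᵘ (p / d) ℚᵘ.≃ mkℚᵘ p (ℕ.pred d)
toℚᵘ-/ p (suc d) = ℚP.toℚᵘ-fromℚᵘ (mkℚᵘ p d)

/-<-/ : ∀ p q a b .{{_ : NonZero a}} .{{_ : NonZero b}} →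
        p * + b < q * + a → p / a ℚ.< q / b
/-<-/ p q a@(suc _) b@(suc _) lt = ℚP.toℚᵘ-cancel-<
  (ℚᵘP.<-respˡ-≃ (ℚᵘP.≃-sym (toℚᵘ-/ p a)) (ℚᵘP.<-respʳ-≃ (ℚᵘP.≃-sym (toℚᵘ-/ q b)) (*<* lt)))

/-≤-/ : ∀ p q a b .{{_ : NonZero a}} .{{_ : NonZero b}} →
        p * + b ≤ q * + a → p / a ℚ.≤ q / b
/-≤-/ p q a@(suc _) b@(suc _) le = ℚP.toℚᵘ-cancel-≤
  (ℚᵘP.≤-respˡ-≃ (ℚᵘP.≃-sym (toℚᵘ-/ p a)) (ℚᵘP.≤-respʳ-≃ (ℚᵘP.≃-sym (toℚᵘ-/ q b)) (*≤* le)))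

≤-/⇒ : ∀ k p d .{{_ : NonZero d}} → k ℚ.≤ p / d → ↥ k * + d ≤ p * ↧ k
≤-/⇒ k@record{} p d@(suc _) le = ℚᵘP.drop-*≤* (ℚᵘP.≤-respʳ-≃ (toℚᵘ-/ p d) (ℚP.toℚᵘ-mono-≤ le))

/-<⇒ : ∀ k p d .{{_ : NonZero d}} → p / d ℚ.< k → p * ↧ k < ↥ k * + d
/-<⇒ k@record{} p d@(suc _) lt = ℚᵘP.drop-*<* (ℚᵘP.<-respˡ-≃ (toℚᵘ-/ p d) (ℚP.toℚᵘ-mono-< lt))

frac-/ : ∀ p d .{{_ : NonZero d}} → frac p d ≡ p / d
frac-/ p (suc d) = refl

module _ (s a b M D : ℤ) where

  threshold-below : 0ℤ ≤ M → 0ℤ < D → a * D ≤ s * b →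
                    (M * (+ 2 * b + a) - + 1) * (+ 3 * D) < (s + + 2 * D) * (+ 3 * M * b)
  threshold-below 0≤M 0<D aD≤sb = begin-strict
    (M * (+ 2 * b + a) - + 1) * (+ 3 * D)              ≡⟨ solve (s ∷ a ∷ b ∷ M ∷ D ∷ []) ⟩
    (+ 3 * (M * (a * D)) + + 6 * M * b * D) - + 3 * D  <⟨ ℤP.+-monoʳ-< (+ 3 * (M * (a * D)) + + 6 * M * b * D) -3D<0 ⟩
    (+ 3 * (M * (a * D)) + + 6 * M * b * D) + 0ℤ      ≡⟨ ℤP.+-identityʳ _ ⟩
    + 3 * (M * (a * D)) + + 6 * M * b * D              ≤⟨ ℤP.+-monoˡ-≤ (+ 6 * M * b * D) 3MaD≤3Msb ⟩
    + 3 * (M * (s * b)) + + 6 * M * b * D              ≡⟨ solve (s ∷ a ∷ b ∷ M ∷ D ∷ []) ⟩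
    (s + + 2 * D) * (+ 3 * M * b)                      ∎
    where
    open ℤP.≤-Reasoning
    instance _ = ℤ.nonNegative 0≤M
    -3D<0 : - (+ 3 * D) < 0ℤ
    -3D<0 = ℤP.neg-mono-< (ℤP.*-monoˡ-<-pos (+ 3) 0<D)
    3MaD≤3Msb : + 3 * (M * (a * D)) ≤ + 3 * (M * (s * b))
    3MaD≤3Msb = ℤP.*-monoˡ-≤-nonNeg (+ 3) (ℤP.*-monoˡ-≤-nonNeg M aD≤sb)

  threshold-above : 0ℤ < D → D ≤ M → s * b < a * D →
                    (s + + 2 * D) * (+ 3 * M * b) ≤ (M * (+ 2 * b + a) - + 1) * (+ 3 * D)
  threshold-above 0<D D≤M sb<aD = begin
    (s + + 2 * D) * (+ 3 * M * b)                              ≡⟨ solve (s ∷ a ∷ b ∷ M ∷ D ∷ []) ⟩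
    + 3 * (M * (+ 1 + s * b)) + (+ 6 * M * b * D - + 3 * M)    ≤⟨ ℤP.+-monoˡ-≤ (+ 6 * M * b * D - + 3 * M) 3M[sb+1]≤3MaD ⟩
    + 3 * (M * (a * D)) + (+ 6 * M * b * D - + 3 * M)          ≤⟨ ℤP.+-monoʳ-≤ (+ 3 * (M * (a * D))) -3M≤-3D ⟩
    + 3 * (M * (a * D)) + (+ 6 * M * b * D - + 3 * D)          ≡⟨ solve (s ∷ a ∷ b ∷ M ∷ D ∷ []) ⟩
    (M * (+ 2 * b + a) - + 1) * (+ 3 * D)                      ∎
    where
    open ℤP.≤-Reasoning
    instance _ = ℤ.nonNegative (ℤP.<⇒≤ (ℤP.<-≤-trans 0<D D≤M))
    3M[sb+1]≤3MaD : + 3 * (M * (+ 1 + s * b)) ≤ + 3 * (M * (a * D))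
    3M[sb+1]≤3MaD = ℤP.*-monoˡ-≤-nonNeg (+ 3) (ℤP.*-monoˡ-≤-nonNeg M (ℤP.i<j⇒suc[i]≤j sb<aD))
    -3M≤-3D : + 6 * M * b * D - + 3 * M ≤ + 6 * M * b * D - + 3 * D
    -3M≤-3D = ℤP.+-monoʳ-≤ (+ 6 * M * b * D) (ℤP.neg-mono-≤ (ℤP.*-monoˡ-≤-nonNeg (+ 3) D≤M))

p-[p-q]≡q : ∀ p q → p ℚ.- (p ℚ.- q) ≡ q
p-[p-q]≡q p q = begin
  p ℚ.- (p ℚ.- q)   ≡⟨ cong (p ℚ.+_) (⁻¹-anti-homo‿- p q) ⟩
  p ℚ.+ (q ℚ.- p)   ≡⟨ ℚP.+-assoc p q (ℚ.- p) ⟨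
  p ℚ.+ q ℚ.- p     ≡⟨ xyx⁻¹≈y p q ⟩
  q                 ∎
  where
  open ≡-Reasoning
  open AbelianGroupProperties ℚP.+-0-abelianGroup

-- (2 + k)/3 − 1/(3 M ↧k), as a single fraction.
threshold : (M : ℕ) .{{_ : NonZero M}} → ℚ → ℚ
threshold M k = (+ M * (+ 2 * ↧ k + ↥ k) - + 1) / (3 ℕ.* M ℕ.* ↧ₙ k)
  where instance _ = ℕP.m*n≢0 3 M
                 _ = ℕP.m*n≢0 (3 ℕ.* M) (↧ₙ k)

-- |δ_T(A')| / |δ_{G'}(A')| for a cut A of G with d edges of total weight s.
cutRatio : ℤ → (d : ℕ) .{{_ : NonZero d}} → ℚ
cutRatio s d = (s + + 2 * + d) / (3 ℕ.* d)
  where instance _ = ℕP.m*n≢0 3 d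

module _ (M : ℕ) .{{_ : NonZero M}} (k : ℚ) (s : ℤ) (d : ℕ) .{{_ : NonZero d}} where

  private
    instance
      _ = ℕP.m*n≢0 3 d
      _ = ℕP.m*n≢0 3 M
      _ = ℕP.m*n≢0 (3 ℕ.* M) (↧ₙ k)
    L : ℤ
    L = + M * (+ 2 * ↧ k + ↥ k) - + 1
    +3*d : + (3 ℕ.* d) ≡ + 3 * + d
    +3*d = ℤP.pos-* 3 d
    +3*M*↧k : + (3 ℕ.* M ℕ.* ↧ₙ k) ≡ + 3 * + M * ↧ k
    +3*M*↧k = trans (ℤP.pos-* (3 ℕ.* M) (↧ₙ k)) (cong (_* ↧ k) (ℤP.pos-* 3 M))
    0<d : 0ℤ < + d
    0<d = ℤ.+<+ (ℕ.>-nonZero⁻¹ d)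

  k≤s/d⇒threshold<cutRatio : k ℚ.≤ s / d → threshold M k ℚ.< cutRatio s d
  k≤s/d⇒threshold<cutRatio k≤s/d = /-<-/ L (s + + 2 * + d) _ _
    (subst₂ _<_ (cong (L *_) (sym +3*d)) (cong ((s + + 2 * + d) *_) (sym +3*M*↧k))
      (threshold-below s (↥ k) (↧ k) (+ M) (+ d) (ℤ.+≤+ ℕ.z≤n) 0<d (≤-/⇒ k s d k≤s/d)))

  threshold<cutRatio⇒k≤s/d : d ℕ.≤ M → threshold M k ℚ.< cutRatio s d → k ℚ.≤ s / d
  threshold<cutRatio⇒k≤s/d d≤M β<r = ℚP.≮⇒≥ λ s/d<k → ℚP.<-irrefl refl (ℚP.<-≤-trans β<r (r≤β s/d<k))
    where
    r≤β : s / d ℚ.< k → cutRatio s d ℚ.≤ threshold M k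
    r≤β s/d<k = /-≤-/ (s + + 2 * + d) L _ _
      (subst₂ _≤_ (cong ((s + + 2 * + d) *_) (sym +3*M*↧k)) (cong (L *_) (sym +3*d))
        (threshold-above s (↥ k) (↧ k) (+ M) (+ d) 0<d (ℤ.+≤+ d≤M) (/-<⇒ k s d s/d<k)))

count : ∀ {X : Set} → (X → Bool) → List X → ℕ
count p xs = length (filterᵇ p xs)

module _ {X : Set} (p : X → Bool) where

  count-++ : ∀ xs ys → count p (xs ++ ys) ≡ count p xs ℕ.+ count p ys
  count-++ xs ys = trans (cong length (filter-++ (T? ∘ p) xs ys)) (length-++ (filterᵇ p xs))

  count-none : ∀ {xs} → All (λ x → p x ≡ false) xs → count p xs ≡ 0
  count-none rejected = cong length (filter-none (T? ∘ p) (All.map (λ px≡false → subst T px≡false) rejected))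

  count-pos : ∀ {x xs} → x ∈ xs → p x ≡ true → 0 ℕ.< count p xs
  count-pos x∈xs px≡true = filter-some (T? ∘ p) (Any.map (λ { refl → subst T (sym px≡true) tt }) x∈xs)

  count-remove : ∀ {x} xs ys → p x ≡ false → count p (xs ++ x ∷ ys) ≡ count p (xs ++ ys)
  count-remove xs ys px≡false = begin
    count p (xs ++ _ ∷ ys)            ≡⟨ count-++ xs (_ ∷ ys) ⟩
    count p xs ℕ.+ count p (_ ∷ ys)
      ≡⟨ cong (λ zs → count p xs ℕ.+ length zs) (filter-reject (T? ∘ p) (subst T px≡false)) ⟩
    count p xs ℕ.+ count p ys         ≡⟨ count-++ xs ys ⟨
    count p (xs ++ ys)                ∎
    where open ≡-Reasoning

  count-≤ : ∀ xs → count p xs ℕ.≤ length xs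
  count-≤ = length-filter (T? ∘ p)

  count-map-all : ∀ {Z : Set} (f : Z → X) zs → (∀ z → p (f z) ≡ true) → count p (map f zs) ≡ length zs
  count-map-all f zs accepted =
    trans (cong length (filter-all (T? ∘ p) (map⁺ (All.universal (λ z → subst T (sym (accepted z)) tt) zs))))
          (length-map f zs)

  count-map-none : ∀ {Z : Set} (f : Z → X) zs → (∀ z → p (f z) ≡ false) → count p (map f zs) ≡ 0
  count-map-none f zs rejected = count-none (map⁺ (All.universal rejected zs))

  count-concatMap-map : ∀ {Y Z : Set} (f : Y → Z → X) (g : Y → List Z) (q : Y → Bool) →
                        (∀ y z → p (f y z) ≡ q y) →
                        ∀ ys → count p (concatMap (λ y → map (f y) (g y)) ys) ≡ sum (map (length ∘ g) (filterᵇ q ys))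
  count-concatMap-map f g q p∘f≡q [] = refl
  count-concatMap-map f g q p∘f≡q (y ∷ ys) = begin
    count p (map (f y) (g y) ++ concatMap (λ y → map (f y) (g y)) ys)   ≡⟨ count-++ (map (f y) (g y)) _ ⟩
    count p (map (f y) (g y)) ℕ.+ count p (concatMap (λ y → map (f y) (g y)) ys)
                                      ≡⟨ cong (count p (map (f y) (g y)) ℕ.+_) (count-concatMap-map f g q p∘f≡q ys) ⟩
    count p (map (f y) (g y)) ℕ.+ sum (map (length ∘ g) (filterᵇ q ys)) ≡⟨ head-step ⟩
    sum (map (length ∘ g) (filterᵇ q (y ∷ ys)))                         ∎
    where
    open ≡-Reasoning
    head-step : count p (map (f y) (g y)) ℕ.+ sum (map (length ∘ g) (filterᵇ q ys)) ≡
                sum (map (length ∘ g) (filterᵇ q (y ∷ ys)))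
    head-step with q y in qy
    ... | true  = cong (ℕ._+ _) (count-map-all (f y) (g y) (λ z → trans (p∘f≡q y z) qy))
    ... | false = cong (ℕ._+ _) (count-map-none (f y) (g y) (λ z → trans (p∘f≡q y z) qy))

sum-map-const : ∀ {Y : Set} c (ys : List Y) → sum (map (λ _ → c) ys) ≡ c ℕ.* length ys
sum-map-const c []       = sym (ℕP.*-zeroʳ c)
sum-map-const c (y ∷ ys) = trans (cong (c ℕ.+_) (sum-map-const c ys)) (sym (ℕP.*-suc c (length ys)))

sum-map-offset : ∀ {Y : Set} (f : Y → ℕ) (w : Y → ℤ) (c : ℤ) → (∀ y → + f y ≡ w y + c) →
                 ∀ ys → + sum (map f ys) ≡ sumℤ (map w ys) + c * + length ys
sum-map-offset f w c f≡w+c []       = sym (trans (ℤP.+-identityˡ (c * + 0)) (ℤP.*-zeroʳ c))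
sum-map-offset f w c f≡w+c (y ∷ ys) = begin
  + f y + + sum (map f ys)                           ≡⟨ cong₂ _+_ (f≡w+c y) (sum-map-offset f w c f≡w+c ys) ⟩
  (w y + c) + (sumℤ (map w ys) + c * + length ys)    ≡⟨ regroup (w y) c (sumℤ (map w ys)) (+ length ys) ⟩
  (w y + sumℤ (map w ys)) + c * (+ 1 + + length ys)  ∎
  where
  open ≡-Reasoning
  regroup : ∀ a c s n → (a + c) + (s + c * n) ≡ (a + s) + c * (+ 1 + n)
  regroup = solve-∀

All-concatMap⁺ : ∀ {Y Z : Set} {P : Z → Set} {f : Y → List Z} →
                 (∀ y → All P (f y)) → ∀ ys → All P (concatMap f ys)
All-concatMap⁺ Pf ys = concat⁺ (map⁺ (All.universal Pf ys))

crossing : ∀ {V E : Set} → (E → V × V) → (V → Bool) → E → Bool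
crossing ends A e = A (proj₁ (ends e)) xor A (proj₂ (ends e))

module _ (G : Multigraph) (A : Fin (Multigraph.n G) → Bool) where
  open Multigraph G

  Joins-crossing : ∀ e {u v} → Joins (ends e) u v → A u ≡ true → A v ≡ false → crossing ends A e ≡ true
  Joins-crossing e (inj₁ (refl , refl)) Au Av = cong₂ _xor_ Au Av
  Joins-crossing e (inj₂ (refl , refl)) Au Av = cong₂ _xor_ Av Au

  Reach-crossing : ∀ {u v} → Reach G u v → A u ≡ true → A v ≡ false → ∃ λ e → crossing ends A e ≡ true
  Reach-crossing here Au Av with () ← trans (sym Au) Av
  Reach-crossing (step {v = x} e joins reach) Au Av with A x in Ax
  ... | true  = Reach-crossing reach Ax Av
  ... | false = e , Joins-crossing e joins Au Ax

  cut-nonempty : Connected G → Nontrivial A → 0 ℕ.< length (δ ends A edges)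
  cut-nonempty connected ((a , Aa) , (b , Ab)) =
    let e , crosses = Reach-crossing (connected a b) Aa Ab in count-pos (crossing ends A) (∈-allFin e) crosses

  cut-≤ : length (δ ends A edges) ℕ.≤ m
  cut-≤ = ℕP.≤-trans (count-≤ (crossing ends A) (allFin m)) (ℕP.≤-reflexive (length-tabulate (λ e → e)))

module _ {G : Multigraph} (Γ : Gadget G) where
  open Multigraph G
  open Gadget Γ

  crossEdges : List (E' G)
  crossEdges = concatMap (λ e → map (crs e) (allFin 3)) (allFin m)

  -- The clique part of edges' is built with a helper local to Gadget, which cannot be named here;
  -- unification against edges' recovers it as a function of (v, i, j) that `with` can split on.
  private
    edges'-shape : Σ (Fin n → Fin (cliqueSize G) → Fin (cliqueSize G) → List (E' G)) λ F →
                   edges' ≡ concatMap (λ v → concatMap (λ i → concatMap (F v i) (allFin _)) (allFin _)) (allFin n)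
                            ++ crossEdges
    edges'-shape = _ , refl

    cliqueBlock-cliques : ∀ v i j → All IsCliqueEdge (proj₁ edges'-shape v i j)
    cliqueBlock-cliques v i j with toℕ i <ᵇ toℕ j
    ... | true  = tt All.∷ All.[]
    ... | false = All.[]

  edges'-split : Σ (List (E' G)) λ K → All IsCliqueEdge K × edges' ≡ K ++ crossEdges
  edges'-split =
    _ , All-concatMap⁺ (λ v → All-concatMap⁺ (λ i → All-concatMap⁺ (cliqueBlock-cliques v i) vs) vs) (allFin n)
      , proj₂ edges'-shape
    where vs = allFin (cliqueSize G)

module _ {G : Multigraph} (Γ : Gadget G) (A : Fin (Multigraph.n G) → Bool) where
  open Multigraph G
  open Gadget Γ

  private
    cut : List (Fin m)
    cut = δ ends A edges
    crosses' : E' G → Bool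
    crosses' = crossing ends' (liftCut {G} A)

  clique-uncut : ∀ e → IsCliqueEdge e → crosses' e ≡ false
  clique-uncut (clq v i j) _ = xor-same (A v)

  count-cliques : ∀ {H} → All IsCliqueEdge H → count crosses' H ≡ 0
  count-cliques cliques = count-none crosses' (All.map (clique-uncut _) cliques)

  δ-edges' : length (δ ends' (liftCut {G} A) edges') ≡ 3 ℕ.* length cut
  δ-edges' with K , K-cliques , edges'≡ ← edges'-split Γ = begin
    count crosses' edges'                          ≡⟨ cong (count crosses') edges'≡ ⟩
    count crosses' (K ++ crossEdges Γ)             ≡⟨ count-++ crosses' K (crossEdges Γ) ⟩
    count crosses' K ℕ.+ count crosses' (crossEdges Γ)
      ≡⟨ cong₂ ℕ._+_ (count-cliques K-cliques)
                   (count-concatMap-map crosses' crs (λ _ → allFin 3) (crossing ends A) (λ _ _ → refl) (allFin m)) ⟩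
    sum (map (λ _ → 3) cut)                        ≡⟨ sum-map-const 3 cut ⟩
    3 ℕ.* length cut                               ∎
    where open ≡-Reasoning

  δ-Sgraph : ∀ (w : Fin m → ℤ) (P : PathAndSelection G w) →
             + length (δ ends' (liftCut {G} A) (Sgraph G w P)) ≡ sumℤ (map w cut) + + 2 * + length cut
  δ-Sgraph w P = begin
    + count crosses' (pathEdges ++ selectedEdges)                 ≡⟨ cong +_ (count-++ crosses' pathEdges selectedEdges) ⟩
    + (count crosses' pathEdges ℕ.+ count crosses' selectedEdges)
      ≡⟨ cong (λ c → + (c ℕ.+ count crosses' selectedEdges)) (count-cliques pathEdges-cliques) ⟩
    + count crosses' selectedEdges
      ≡⟨ cong +_ (count-concatMap-map crosses' crs sel (crossing ends A) (λ _ _ → refl) (allFin m)) ⟩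
    + sum (map (length ∘ sel) cut)                                ≡⟨ sum-map-offset (length ∘ sel) w (+ 2) selSize cut ⟩
    sumℤ (map w cut) + + 2 * + length cut                         ∎
    where
    open ≡-Reasoning
    open PathAndSelection P
    pathEdges selectedEdges : List (E' G)
    pathEdges = concatMap (λ v → map (λ ij → clq v (proj₁ ij) (proj₂ ij)) (pathPairs (σ v))) (allFin n)
    selectedEdges = concatMap (λ e → map (crs e) (sel e)) (allFin m)
    pathEdges-cliques : All IsCliqueEdge pathEdges
    pathEdges-cliques = All-concatMap⁺ (λ v → map⁺ (All.universal (λ _ → tt) (pathPairs (σ v)))) (allFin n)

  δ-Step : ∀ {H H′} → Step Γ H H′ → length (δ ends' (liftCut {G} A) H′) ≡ length (δ ends' (liftCut {G} A) H)
  δ-Step {H} {H′} (C , i , clique , xs , ys , H≡ , H′≡) = begin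
    count crosses' H′                           ≡⟨ cong (count crosses') H′≡ ⟩
    count crosses' (xs ++ ys)                   ≡⟨ count-remove crosses' xs ys (clique-uncut (Cycle.edg C i) clique) ⟨
    count crosses' (xs ++ Cycle.edg C i ∷ ys)   ≡⟨ cong (count crosses') H≡ ⟨
    count crosses' H                            ∎
    where open ≡-Reasoning

  δ-Star : ∀ {H H′} → Star (Step Γ) H H′ → length (δ ends' (liftCut {G} A) H′) ≡ length (δ ends' (liftCut {G} A) H)
  δ-Star Star.ε           = refl
  δ-Star (s Star.◅ steps) = trans (δ-Star steps) (δ-Step s)

lemma1 : (G : Multigraph) → Loopless G → Connected G → 1 ℕ.≤ Multigraph.m G →
         (W : Weights G) → (k : ℚ) → ℚ.- ℚ.1ℚ ℚ.≤ k →
         (Γ : Gadget G) (P : PathAndSelection G (proj₁ W)) (T : List (E' G)) →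
         IsResultT Γ (Sgraph G (proj₁ W) P) T →
         ∃ λ (ε : ℚ) →
           (∀ A → Nontrivial A → k ℚ.≤ cutAvg G (proj₁ W) A →
              alpha k ε ℚ.< treeRatio Γ T (liftCut {G} A))
           × (∀ A → Nontrivial A → alpha k ε ℚ.< treeRatio Γ T (liftCut {G} A) →
              k ℚ.≤ cutAvg G (proj₁ W) A)
lemma1 G _ connected 1≤m (w , _) k _ Γ P T (S→T , _) =
  ε , (λ A nontrivial → let open CutCounts A nontrivial in λ k≤avg →
         subst₂ ℚ._<_ (sym α≡β) (sym ratio≡)
           (k≤s/d⇒threshold<cutRatio m k s d (subst (k ℚ.≤_) avg≡ k≤avg)))
    , (λ A nontrivial → let open CutCounts A nontrivial in λ α<ratio →
         subst (k ℚ.≤_) (sym avg≡)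
           (threshold<cutRatio⇒k≤s/d m k s d (cut-≤ G A) (subst₂ ℚ._<_ α≡β ratio≡ α<ratio)))
  where
  open Multigraph G
  instance _ = ℕ.>-nonZero 1≤m
  [2+k]/3 ε : ℚ
  [2+k]/3 = ((+ 2 ℚ./ 1) ℚ.+ k) ℚ.* (+ 1 ℚ./ 3)
  ε = [2+k]/3 ℚ.- threshold m k
  α≡β : alpha k ε ≡ threshold m k
  α≡β = p-[p-q]≡q [2+k]/3 (threshold m k)

  module CutCounts (A : Fin n → Bool) (nontrivial : Nontrivial A) where
    d : ℕ
    d = length (δ ends A edges)
    s : ℤ
    s = sumℤ (map w (δ ends A edges))
    instance
      d≢0 : NonZero d
      d≢0 = ℕ.>-nonZero (cut-nonempty G A connected nontrivial)
    ratio≡ : treeRatio Γ T (liftCut {G} A) ≡ cutRatio s d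
    ratio≡ = begin
      frac (+ length (δ ends' (liftCut {G} A) T)) (length (δ ends' (liftCut {G} A) edges'))
        ≡⟨ cong₂ frac (trans (cong +_ (δ-Star Γ A S→T)) (δ-Sgraph Γ A w P)) (δ-edges' Γ A) ⟩
      frac (s + + 2 * + d) (3 ℕ.* d)    ≡⟨ frac-/ (s + + 2 * + d) (3 ℕ.* d) ⟩
      cutRatio s d                      ∎
      where
      open ≡-Reasoning
      open Gadget Γ
      instance _ = ℕP.m*n≢0 3 d
    avg≡ : cutAvg G w A ≡ s / d
    avg≡ = frac-/ s d
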